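{- Let $n\geq 1$ be an integer and let $a,b,x\in\mathbb{C}$. Then $$\sum_{k=0}^{n-1}\frac{1}{n}\binom{n}{k}\binom{n}{k+1} x^{2k} b^{\,n-1-k}= \sum_{k=0}^{n-1}\binom{n-1}{k} M_{k}^{(a,b)}\,x^k\,(x^2-ax+b)^{n-1-k}.$$
   Context: A Motzkin path of order $m\geq 0$ is a lattice path from $(0,0)$ to $(m,m)$ using steps $\mathbf{D}=(1,1)$, $\mathbf{N}_2=(0,2)$, $\mathbf{E}_2=(2,0)$ that never goes below the line $y=x$ (the empty path is the unique path of order $0$). The $(a,b)$-Motzkin number is $M_m^{(a,b)}=\sum_P a^{\#\mathbf{D}(P)}\,b^{\#\mathbf{E}_2(P)}$, the sum over all Motzkin paths $P$ of order $m$, where $\#\mathbf{D}(P)$ and $\#\mathbf{E}_2(P)$ are the numbers of $\mathbf{D}$ and $\mathbf{E}_2$ steps of $P$. Equivalently $M_m^{(a,b)}=\sum_{j=0}^{\lfloor m/2\rfloor}\binom{m}{2j}C_j a^{m-2j}b^j$ with $C_j=\frac{1}{j+1}\binom{2j}{j}$ the Catalan numbers. -}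

module Defs where

open import Level using (Level)
open import Data.Bool using (Bool; true; false; _∧_)
open import Data.Nat using (ℕ; zero; suc; _≡ᵇ_; _≤ᵇ_)
open import Data.List using (List; []; _∷_; [_]; map; concatMap; filterᵇ; upTo)
open import Algebra.Bundles using (CommutativeRing)

-- Steps of a Motzkin path: D = (1,1), N₂ = (0,2), E₂ = (2,0).
data Step : Set where
  D N₂ E₂ : Step

words : ℕ → List (List Step)
words zero = [ [] ]
words (suc n) = concatMap (λ w → (D ∷ w) ∷ (N₂ ∷ w) ∷ (E₂ ∷ w) ∷ []) (words n)

-- Does the word, started at (x,y), stay weakly above y = x and end at (m,m)?
validFrom : ℕ → ℕ → ℕ → List Step → Bool
validFrom m x y [] = (x ≡ᵇ m) ∧ (y ≡ᵇ m)
validFrom m x y (D ∷ w) = validFrom m (suc x) (suc y) w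
validFrom m x y (N₂ ∷ w) = validFrom m x (suc (suc y)) w
validFrom m x y (E₂ ∷ w) = (suc (suc x) ≤ᵇ y) ∧ validFrom m (suc (suc x)) y w

isMotzkin : ℕ → List Step → Bool
isMotzkin m w = validFrom m 0 0 w

-- Every step increases x+y by 2, so a path of order m has exactly m steps.
motzkinPaths : ℕ → List (List Step)
motzkinPaths m = filterᵇ (isMotzkin m) (words m)

#D : List Step → ℕ
#D [] = 0
#D (D ∷ w) = suc (#D w)
#D (_ ∷ w) = #D w

#E₂ : List Step → ℕ
#E₂ [] = 0
#E₂ (E₂ ∷ w) = suc (#E₂ w)
#E₂ (_ ∷ w) = #E₂ w

module _ {c ℓ : Level} (R : CommutativeRing c ℓ) where
  open CommutativeRing R

  pow : Carrier → ℕ → Carrier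
  pow x zero = 1#
  pow x (suc n) = x * pow x n

  fromℕ : ℕ → Carrier
  fromℕ zero = 0#
  fromℕ (suc n) = 1# + fromℕ n

  sumR : List Carrier → Carrier
  sumR [] = 0#
  sumR (x ∷ xs) = x + sumR xs

  Σ< : ℕ → (ℕ → Carrier) → Carrier
  Σ< n f = sumR (map f (upTo n))

  Motzkin : Carrier → Carrier → ℕ → Carrier
  Motzkin a b m = sumR (map (λ P → pow a (#D P) * pow b (#E₂ P)) (motzkinPaths m))

-- Let paths l u d N h be the total weight of the length-N paths from height h down to 0 with level,
-- up and down steps weighted l, u, d.  Reading D, N₂, E₂ as level, up and down steps identifies
-- M_k^(a,b) with paths a 1 b k 0, and giving every step an extra factor x turns this into
-- x^k M_k^(a,b) = paths (a x) x (b x) k 0.  Both sides of the identity are then expansions of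
-- paths (x² + b) x (b x) (n - 1) 0:
--  * writing the level weight as x² + b = a x + y with y = x² - a x + b and choosing, for each level
--    step, either the summand a x or the scalar y gives the binomial expansion
--    Σ_k C(n-1, k) paths (a x) x (b x) k 0 · y^(n-1-k), the right-hand side;
--  * expanding in monomials, the coefficient of x^(2k+h) b^(N-k) in paths (x² + b) x (b x) N h obeys a
--    Pascal-like recurrence solved by the ballot numbers (h+1)/(N+1) C(N+1, k) C(N+1, k+h+1), which at
--    h = 0 are the Narayana numbers of the left-hand side.

module Submission where

open import Defs
open import Level using (Level)
open import Data.Nat as ℕ using (ℕ; zero; suc; _∸_; _<_; z≤n; s≤s; NonZero)
open import Data.Nat.Properties as ℕ using ()
open import Data.Nat.Combinatorics using (_C_)
open import Data.Empty.Irrelevant using (⊥-elim)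
open import Algebra.Bundles using (CommutativeRing)

module Binomial where
  open import Data.Nat
  open import Data.Nat.Properties
  open import Data.Nat.Tactic.RingSolver using (solve-∀)
  open import Data.Nat.Combinatorics using (nCk+nC[k+1]≡[n+1]C[k+1])
  open import Relation.Binary.PropositionalEquality

  binom : ℕ → ℕ → ℕ
  binom n zero = 1
  binom zero (suc k) = 0
  binom (suc n) (suc k) = binom n k + binom n (suc k)

  below : (ℕ → ℕ) → ℕ → ℕ
  below g zero = 0
  below g (suc h) = g h

  binom-suc : ∀ n k → binom (suc n) k ≡ binom n k + below (binom n) k
  binom-suc n zero = refl
  binom-suc n (suc k) = +-comm (binom n k) (binom n (suc k))

  binom≡C : ∀ n k → binom n k ≡ n C k
  binom≡C n zero = refl
  binom≡C zero (suc k) = refl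
  binom≡C (suc n) (suc k) =
    trans (cong₂ _+_ (binom≡C n k) (binom≡C n (suc k))) (nCk+nC[k+1]≡[n+1]C[k+1] n k)

  binom-vanish : ∀ {n k} → n < k → binom n k ≡ 0
  binom-vanish {zero} {suc k} _ = refl
  binom-vanish {suc n} {suc k} (s≤s n<k) =
    cong₂ _+_ (binom-vanish n<k) (binom-vanish (m≤n⇒m≤1+n n<k))

  binom-absorption : ∀ n k → suc k * binom n (suc k) + k * binom n k ≡ n * binom n k
  binom-absorption zero zero = refl
  binom-absorption zero (suc k) = cong₂ _+_ (*-zeroʳ (suc (suc k))) (*-zeroʳ (suc k))
  binom-absorption (suc n) zero = cong suc (binom-absorption n zero)
  binom-absorption (suc n) (suc k) = +-cancelʳ-≡ _ _ _ (begin
      suc (suc k) * (B₁ + B₂) + suc k * (B₀ + B₁) + (n * B₁ + n * B₀)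
        ≡⟨ expand n k B₀ B₁ B₂ ⟩
      suc n * (B₀ + B₁) + ((suc (suc k) * B₂ + suc k * B₁) + (suc k * B₁ + k * B₀))
        ≡⟨ cong (λ t → suc n * (B₀ + B₁) + t) (cong₂ _+_ (binom-absorption n (suc k)) (binom-absorption n k)) ⟩
      suc n * (B₀ + B₁) + (n * B₁ + n * B₀) ∎)
    where
    open ≡-Reasoning
    B₀ B₁ B₂ : ℕ
    B₀ = binom n k
    B₁ = binom n (suc k)
    B₂ = binom n (suc (suc k))
    expand : ∀ n k B₀ B₁ B₂ →
      suc (suc k) * (B₁ + B₂) + suc k * (B₀ + B₁) + (n * B₁ + n * B₀)
        ≡ suc n * (B₀ + B₁) + ((suc (suc k) * B₂ + suc k * B₁) + (suc k * B₁ + k * B₀))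
    expand = solve-∀

module Ballot where
  open import Data.Nat
  open import Data.Nat.Properties
  open import Data.Nat.Tactic.RingSolver using (solve-∀)
  open import Data.Nat.DivMod using (m*n/n≡m)
  open import Algebra.Properties.CommutativeSemigroup *-commutativeSemigroup using (x∙yz≈y∙xz)
  open import Relation.Binary.PropositionalEquality
  open ≡-Reasoning
  open Binomial

  -- ballot N h k is the coefficient of x^(2k+h) b^(N-k) in paths (x² + b) x (b x) N h.
  ballot : ℕ → ℕ → ℕ → ℕ
  ballot zero zero zero = 1
  ballot zero zero (suc k) = 0
  ballot zero (suc h) k = 0
  ballot (suc N) h zero = ballot N h 0 + below (λ h' → ballot N h' 0) h
  ballot (suc N) h (suc k) =
    ballot N h k + ballot N h (suc k) + ballot N (suc h) k + below (λ h' → ballot N h' (suc k)) h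

  ballotFormula : ℕ → ℕ → ℕ → ℕ
  ballotFormula N h k = suc h * (binom (suc N) k * binom (suc N) (suc (k + h)))

  ballot-vanish : ∀ N h {k} → N < k → ballot N h k ≡ 0
  ballot-vanish zero zero {suc k} _ = refl
  ballot-vanish zero (suc h) _ = refl
  ballot-vanish (suc N) h {suc k} (s≤s N<k) = cong₂ _+_
    (cong₂ _+_ (cong₂ _+_ (ballot-vanish N h N<k) (ballot-vanish N h N<1+k)) (ballot-vanish N (suc h) N<k))
    (below-vanish h)
    where
    N<1+k : N < suc k
    N<1+k = m≤n⇒m≤1+n N<k
    below-vanish : ∀ h → below (λ h' → ballot N h' (suc k)) h ≡ 0
    below-vanish zero = refl
    below-vanish (suc h) = ballot-vanish N h N<1+k

  +-cancelʳ-≡′ : ∀ {m n p q} → p ≡ q → m + q ≡ n + p → m ≡ n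
  +-cancelʳ-≡′ refl = +-cancelʳ-≡ _ _ _

  *-distribˡ-+₄ : ∀ m a b c d → m * (a + b + c + d) ≡ m * a + m * b + m * c + m * d
  *-distribˡ-+₄ = solve-∀

  ballot-formula : ∀ N h k → suc N * ballot N h k ≡ ballotFormula N h k
  below-formula : ∀ N h k → suc N * below (λ h' → ballot N h' k) h ≡ h * (binom (suc N) k * binom (suc N) (k + h))

  ballot-formula zero zero zero = refl
  ballot-formula zero zero (suc k) = sym (cong (1 *_) (*-zeroʳ (binom 1 (suc k))))
  ballot-formula zero (suc h) k = sym (begin
      suc (suc h) * (binom 1 k * binom 1 (suc (k + suc h)))
        ≡⟨ cong (λ n → suc (suc h) * (binom 1 k * n)) (binom-vanish (s≤s (≤-trans (s≤s z≤n) (m≤n+m (suc h) k)))) ⟩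
      suc (suc h) * (binom 1 k * 0)
        ≡⟨ cong (suc (suc h) *_) (*-zeroʳ (binom 1 k)) ⟩
      suc (suc h) * 0
        ≡⟨ *-zeroʳ (suc (suc h)) ⟩
      0 ∎)
  ballot-formula (suc N) h zero = *-cancelˡ-≡ _ _ (suc N) (begin
      suc N * (suc (suc N) * ballot (suc N) h 0)
        ≡⟨ x∙yz≈y∙xz (suc N) (suc (suc N)) (ballot (suc N) h 0) ⟩
      suc (suc N) * (suc N * (ballot N h 0 + below (λ h' → ballot N h' 0) h))
        ≡⟨ cong (suc (suc N) *_) (*-distribˡ-+ (suc N) (ballot N h 0) _) ⟩
      suc (suc N) * (suc N * ballot N h 0 + suc N * below (λ h' → ballot N h' 0) h)
        ≡⟨ cong (suc (suc N) *_) (cong₂ _+_ (ballot-formula N h 0) (below-formula N h 0)) ⟩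
      suc (suc N) * (ballotFormula N h 0 + h * (1 * B₀))
        ≡⟨ +-cancelʳ-≡′ (binom-absorption (suc N) h) (identity (suc N) h B₀ B₁) ⟩
      suc N * ballotFormula (suc N) h 0 ∎)
    where
    B₀ B₁ : ℕ
    B₀ = binom (suc N) h
    B₁ = binom (suc N) (suc h)
    identity : ∀ M h B₀ B₁ → suc M * (suc h * (1 * B₁) + h * (1 * B₀)) + M * B₀
                            ≡ M * (suc h * (1 * (B₀ + B₁))) + (suc h * B₁ + h * B₀)
    identity = solve-∀
  ballot-formula (suc N) h (suc j) = *-cancelˡ-≡ _ _ (suc N) (begin
      suc N * (suc (suc N) * ballot (suc N) h (suc j))
        ≡⟨ x∙yz≈y∙xz (suc N) (suc (suc N)) (ballot (suc N) h (suc j)) ⟩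
      suc (suc N) * (suc N * (ballot N h j + ballot N h (suc j) + ballot N (suc h) j + below (λ h' → ballot N h' (suc j)) h))
        ≡⟨ cong (suc (suc N) *_) (*-distribˡ-+₄ (suc N) (ballot N h j) (ballot N h (suc j)) (ballot N (suc h) j) (below (λ h' → ballot N h' (suc j)) h)) ⟩
      suc (suc N) * (suc N * ballot N h j + suc N * ballot N h (suc j) + suc N * ballot N (suc h) j
                     + suc N * below (λ h' → ballot N h' (suc j)) h)
        ≡⟨ cong (suc (suc N) *_) (cong₂ _+_ (cong₂ _+_ (cong₂ _+_ (ballot-formula N h j) (ballot-formula N h (suc j)))
              (trans (ballot-formula N (suc h) j) (cong (λ i → suc (suc h) * (L₀ * binom (suc N) i)) (+-suc (suc j) h))))
              (below-formula N h (suc j))) ⟩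
      suc (suc N) * (suc h * (L₀ * H₀) + suc h * (L₁ * H₁) + suc (suc h) * (L₀ * H₁) + h * (L₁ * H₀))
        ≡⟨ absorbed ⟩
      suc N * ballotFormula (suc N) h (suc j) ∎)
    where
    L₀ L₁ H₀ H₁ : ℕ
    L₀ = binom (suc N) j
    L₁ = binom (suc N) (suc j)
    H₀ = binom (suc N) (suc (j + h))
    H₁ = binom (suc N) (suc (suc (j + h)))
    -- a polynomial identity once the absorption relations for C(N+1, j) and C(N+1, j+h+1),
    -- multiplied by H₀ + H₁ and L₀ + L₁, are added to both sides
    identity : ∀ M j h L₀ L₁ H₀ H₁ →
      suc M * (suc h * (L₀ * H₀) + suc h * (L₁ * H₁) + suc (suc h) * (L₀ * H₁) + h * (L₁ * H₀))
        + ((H₀ + H₁) * (suc j * L₁ + j * L₀) + (L₀ + L₁) * (M * H₀))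
      ≡ M * (suc h * ((L₀ + L₁) * (H₀ + H₁)))
        + ((H₀ + H₁) * (M * L₀) + (L₀ + L₁) * (suc (suc (j + h)) * H₁ + suc (j + h) * H₀))
    identity = solve-∀
    absorbed : suc (suc N) * (suc h * (L₀ * H₀) + suc h * (L₁ * H₁) + suc (suc h) * (L₀ * H₁) + h * (L₁ * H₀))
             ≡ suc N * ballotFormula (suc N) h (suc j)
    absorbed = +-cancelʳ-≡′
      (cong₂ (λ u v → (H₀ + H₁) * u + (L₀ + L₁) * v)
             (sym (binom-absorption (suc N) j)) (binom-absorption (suc N) (suc (j + h))))
      (identity (suc N) j h L₀ L₁ H₀ H₁)

  below-formula N zero k = *-zeroʳ (suc N)
  below-formula N (suc h) k =
    trans (ballot-formula N h k) (cong (λ i → suc h * (binom (suc N) k * binom (suc N) i)) (sym (+-suc k h)))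

  ballot≡narayana : ∀ N k → ballot N 0 k ≡ ((suc N C k) * (suc N C suc k)) / suc N
  ballot≡narayana N k = sym (begin
      ((suc N C k) * (suc N C suc k)) / suc N
        ≡⟨ cong (_/ suc N) (sym (cong₂ _*_ (binom≡C (suc N) k) (binom≡C (suc N) (suc k)))) ⟩
      (binom (suc N) k * binom (suc N) (suc k)) / suc N
        ≡⟨ cong (_/ suc N) (begin
           binom (suc N) k * binom (suc N) (suc k)   ≡⟨ cong (λ i → binom (suc N) k * binom (suc N) (suc i)) (sym (+-identityʳ k)) ⟩
           binom (suc N) k * binom (suc N) (suc (k + 0)) ≡⟨ sym (+-identityʳ _) ⟩
           ballotFormula N 0 k ≡⟨ sym (ballot-formula N 0 k) ⟩
           suc N * ballot N 0 k ≡⟨ *-comm (suc N) _ ⟩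
           ballot N 0 k * suc N ∎) ⟩
      (ballot N 0 k * suc N) / suc N
        ≡⟨ m*n/n≡m (ballot N 0 k) (suc N) ⟩
      ballot N 0 k ∎)

module WeightedPaths {c ℓ : Level} (R : CommutativeRing c ℓ) where
  open CommutativeRing R
  open import Data.List using (List; []; _∷_; _++_; map; applyUpTo; concatMap; filterᵇ)
  open import Data.Bool using (Bool; true; false; if_then_else_; T)
  open import Data.Unit using (tt)
  open import Data.Bool.Properties using (T-∧)
  open import Data.Product using (_,_; proj₂)
  open import Function.Bundles using (Equivalence)
  open import Relation.Nullary using (¬_; yes; no)
  open import Relation.Binary.PropositionalEquality as ≡ using (_≡_)
  open import Relation.Binary.Reasoning.Setoid setoid
  open import Algebra.Solver.Ring.NaturalCoefficients.Default commutativeSemiring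
    using (solve; _:=_; _:+_; _:*_)
  open Binomial using (binom; binom-suc; binom-vanish)
  open import Data.Nat.Tactic.RingSolver using (solve-∀)

  infixr 8 _^_
  _^_ : Carrier → ℕ → Carrier
  x ^ n = pow R x n

  ∑ : ℕ → (ℕ → Carrier) → Carrier
  ∑ zero f = 0#
  ∑ (suc n) f = f 0 + ∑ n (λ k → f (suc k))

  Σ<≡∑ : ∀ n f → Σ< R n f ≡ ∑ n f
  Σ<≡∑ n f = sum-applyUpTo n (λ k → k)
    where
    sum-applyUpTo : ∀ n (g : ℕ → ℕ) → sumR R (map f (applyUpTo g n)) ≡ ∑ n (λ k → f (g k))
    sum-applyUpTo zero g = ≡.refl
    sum-applyUpTo (suc n) g = ≡.cong (f (g 0) +_) (sum-applyUpTo n (λ k → g (suc k)))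

  ∑-cong : ∀ n {f g : ℕ → Carrier} → (∀ k → f k ≈ g k) → ∑ n f ≈ ∑ n g
  ∑-cong zero f≈g = refl
  ∑-cong (suc n) f≈g = +-cong (f≈g 0) (∑-cong n (λ k → f≈g (suc k)))

  ∑-+ : ∀ n (f g : ℕ → Carrier) → ∑ n (λ k → f k + g k) ≈ ∑ n f + ∑ n g
  ∑-+ zero f g = sym (+-identityˡ 0#)
  ∑-+ (suc n) f g = trans (+-congˡ (∑-+ n _ _)) (interchange _ _ _ _)
    where
    interchange : ∀ a b c d → (a + b) + (c + d) ≈ (a + c) + (b + d)
    interchange = solve 4 (λ a b c d → (a :+ b) :+ (c :+ d) := (a :+ c) :+ (b :+ d)) refl

  ∑-distribˡ : ∀ n a (f : ℕ → Carrier) → ∑ n (λ k → a * f k) ≈ a * ∑ n f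
  ∑-distribˡ zero a f = sym (zeroʳ a)
  ∑-distribˡ (suc n) a f = trans (+-congˡ (∑-distribˡ n a _)) (sym (distribˡ a _ _))

  ∑-zero : ∀ n {f : ℕ → Carrier} → (∀ k → f k ≈ 0#) → ∑ n f ≈ 0#
  ∑-zero zero f≈0 = refl
  ∑-zero (suc n) f≈0 = trans (+-cong (f≈0 0) (∑-zero n (λ k → f≈0 (suc k)))) (+-identityˡ 0#)

  ∑-last : ∀ n (f : ℕ → Carrier) → ∑ (suc n) f ≈ ∑ n f + f n
  ∑-last zero f = trans (+-identityʳ _) (sym (+-identityˡ _))
  ∑-last (suc n) f = trans (+-congˡ (∑-last n _)) (sym (+-assoc _ _ _))

  ∑-+₃ : ∀ n (f g h : ℕ → Carrier) → ∑ n (λ k → f k + g k + h k) ≈ ∑ n f + ∑ n g + ∑ n h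
  ∑-+₃ n f g h = trans (∑-+ n _ h) (+-congʳ (∑-+ n f g))

  ∑-+₄ : ∀ n (f g h i : ℕ → Carrier) → ∑ n (λ k → f k + g k + h k + i k) ≈ ∑ n f + ∑ n g + ∑ n h + ∑ n i
  ∑-+₄ n f g h i = trans (∑-+ n _ i) (+-congʳ (∑-+₃ n f g h))

  fromℕ-+ : ∀ m n → fromℕ R (m ℕ.+ n) ≈ fromℕ R m + fromℕ R n
  fromℕ-+ zero n = sym (+-identityˡ _)
  fromℕ-+ (suc m) n = trans (+-congˡ (fromℕ-+ m n)) (sym (+-assoc _ _ _))

  distribʳ₂ : ∀ a b X Y → (a + b) * X * Y ≈ a * X * Y + b * X * Y
  distribʳ₂ = solve 4 (λ a b X Y → (a :+ b) :* X :* Y := a :* X :* Y :+ b :* X :* Y) refl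

  zeroˡ₂ : ∀ x y → 0# * x * y ≈ 0#
  zeroˡ₂ x y = trans (*-congʳ (zeroˡ x)) (zeroˡ y)

  -- z^(N+1-k) = z · z^(N-k) fails at k = N+1 (truncated subtraction), where the coefficient vanishes instead.
  pow-suc∸ : ∀ z N k n X → (N < k → n ≡ 0) → fromℕ R n * X * z ^ (suc N ∸ k) ≈ z * (fromℕ R n * X * z ^ (N ∸ k))
  pow-suc∸ z N k n X vanish with k ℕ.≤? N
  ... | yes k≤N = trans (*-congˡ (reflexive (≡.cong (z ^_) (ℕ.+-∸-assoc 1 k≤N)))) (rotate (fromℕ R n) X z _)
    where
    rotate : ∀ c X z Z → c * X * (z * Z) ≈ z * (c * X * Z)
    rotate = solve 4 (λ c X z Z → (c :* X) :* (z :* Z) := z :* ((c :* X) :* Z)) refl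
  ... | no k≰N rewrite vanish (ℕ.≰⇒> k≰N) = trans (zeroˡ₂ X _) (sym (trans (*-congˡ (zeroˡ₂ X _)) (zeroʳ z)))

  below : (ℕ → Carrier) → ℕ → Carrier
  below g zero = 0#
  below g (suc h) = g h

  below-cong : ∀ {g g' : ℕ → Carrier} h → (∀ h' → g h' ≈ g' h') → below g h ≈ below g' h
  below-cong zero g≈g' = refl
  below-cong (suc h) g≈g' = g≈g' h

  below-distribˡ : ∀ a (g : ℕ → Carrier) h → below (λ h' → a * g h') h ≈ a * below g h
  below-distribˡ a g zero = sym (zeroʳ a)
  below-distribˡ a g (suc h) = refl

  below-*ʳ : ∀ a (g : ℕ → Carrier) b h → below (λ h' → a * g h' * b) h ≈ a * below g h * b
  below-*ʳ a g b zero = sym (trans (*-congʳ (zeroʳ a)) (zeroˡ b))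
  below-*ʳ a g b (suc h) = refl

  ∑-below : ∀ n (g : ℕ → ℕ → Carrier) h → ∑ n (λ k → below (λ h' → g h' k) h) ≈ below (λ h' → ∑ n (g h')) h
  ∑-below n g zero = ∑-zero n (λ k → refl)
  ∑-below n g (suc h) = refl

  paths : Carrier → Carrier → Carrier → ℕ → ℕ → Carrier
  paths l u d zero zero = 1#
  paths l u d zero (suc h) = 0#
  paths l u d (suc N) h = l * paths l u d N h + u * paths l u d N (suc h) + below (λ h' → d * paths l u d N h') h

  paths-cong : ∀ {l l' u u' d d'} → l ≈ l' → u ≈ u' → d ≈ d' → ∀ N h → paths l u d N h ≈ paths l' u' d' N h
  paths-cong l≈ u≈ d≈ zero zero = refl
  paths-cong l≈ u≈ d≈ zero (suc h) = refl
  paths-cong l≈ u≈ d≈ (suc N) h =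
    +-cong (+-cong (*-cong l≈ (paths-cong l≈ u≈ d≈ N h)) (*-cong u≈ (paths-cong l≈ u≈ d≈ N (suc h))))
           (below-cong h (λ h' → *-cong d≈ (paths-cong l≈ u≈ d≈ N h')))

  paths-scale : ∀ l u d z N h → paths (l * z) (u * z) (d * z) N h ≈ z ^ N * paths l u d N h
  paths-scale l u d z zero zero = sym (*-identityˡ 1#)
  paths-scale l u d z zero (suc h) = sym (*-identityˡ 0#)
  paths-scale l u d z (suc N) h = begin
      (l * z) * paths (l * z) (u * z) (d * z) N h + (u * z) * paths (l * z) (u * z) (d * z) N (suc h)
        + below (λ h' → (d * z) * paths (l * z) (u * z) (d * z) N h') h
    ≈⟨ +-cong (+-cong (*-congˡ (paths-scale l u d z N h)) (*-congˡ (paths-scale l u d z N (suc h))))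
              (below-cong h (λ h' → trans (*-congˡ (paths-scale l u d z N h')) (rotate d z (z ^ N) _))) ⟩
      (l * z) * (z ^ N * P₀) + (u * z) * (z ^ N * P₁) + below (λ h' → (z * z ^ N) * (d * paths l u d N h')) h
    ≈⟨ +-congˡ (below-distribˡ (z * z ^ N) _ h) ⟩
      (l * z) * (z ^ N * P₀) + (u * z) * (z ^ N * P₁) + (z * z ^ N) * below (λ h' → d * paths l u d N h') h
    ≈⟨ factor l u z (z ^ N) P₀ P₁ _ ⟩
      (z * z ^ N) * (l * P₀ + u * P₁ + below (λ h' → d * paths l u d N h') h) ∎
    where
    P₀ P₁ : Carrier
    P₀ = paths l u d N h
    P₁ = paths l u d N (suc h)
    rotate : ∀ d z Z X → (d * z) * (Z * X) ≈ (z * Z) * (d * X)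
    rotate = solve 4 (λ d z Z X → (d :* z) :* (Z :* X) := (z :* Z) :* (d :* X)) refl
    factor : ∀ l u z Z A B D → (l * z) * (Z * A) + (u * z) * (Z * B) + (z * Z) * D ≈ (z * Z) * (l * A + u * B + D)
    factor = solve 7 (λ l u z Z A B D → (l :* z) :* (Z :* A) :+ (u :* z) :* (Z :* B) :+ (z :* Z) :* D
                                         := (z :* Z) :* (l :* A :+ u :* B :+ D)) refl

  module _ (l u d y : Carrier) where
    expansion : ℕ → ℕ → Carrier
    expansion N h = ∑ (suc N) (λ k → fromℕ R (binom N k) * paths l u d k h * y ^ (N ∸ k))

    expansion-shift : ∀ N h → ∑ (suc (suc N)) (λ k → fromℕ R (binom N k) * paths l u d k h * y ^ (suc N ∸ k))
                              ≈ y * expansion N h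
    expansion-shift N h = begin
        ∑ (suc (suc N)) (λ k → fromℕ R (binom N k) * paths l u d k h * y ^ (suc N ∸ k))
      ≈⟨ ∑-cong (suc (suc N)) (λ k → pow-suc∸ y N k (binom N k) (paths l u d k h) binom-vanish) ⟩
        ∑ (suc (suc N)) (λ k → y * term k)
      ≈⟨ ∑-distribˡ (suc (suc N)) y term ⟩
        y * ∑ (suc (suc N)) term
      ≈⟨ *-congˡ (∑-last (suc N) term) ⟩
        y * (expansion N h + term (suc N))
      ≈⟨ *-congˡ (trans (+-congˡ last-vanishes) (+-identityʳ _)) ⟩
        y * expansion N h ∎
      where
      term : ℕ → Carrier
      term k = fromℕ R (binom N k) * paths l u d k h * y ^ (N ∸ k)
      last-vanishes : term (suc N) ≈ 0#
      last-vanishes = trans (*-congʳ (*-congʳ (reflexive (≡.cong (fromℕ R) (binom-vanish (ℕ.n<1+n N)))))) (zeroˡ₂ _ _)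

    expansion-step : ∀ N h → ∑ (suc (suc N)) (λ k → fromℕ R (Binomial.below (binom N) k) * paths l u d k h * y ^ (suc N ∸ k))
                             ≈ l * expansion N h + u * expansion N (suc h) + d * below (expansion N) h
    expansion-step N h = trans (+-cong (zeroˡ₂ _ _) (begin
        ∑ (suc N) (λ k → fromℕ R (binom N k) * paths l u d (suc k) h * y ^ (N ∸ k))
      ≈⟨ ∑-cong (suc N) (λ k → spread (fromℕ R (binom N k)) (y ^ (N ∸ k)) k) ⟩
        ∑ (suc N) (λ k → l * term k h + u * term k (suc h) + d * below (λ h' → term k h') h)
      ≈⟨ ∑-+₃ (suc N) (λ k → l * term k h) (λ k → u * term k (suc h)) (λ k → d * below (term k) h) ⟩
        ∑ (suc N) (λ k → l * term k h) + ∑ (suc N) (λ k → u * term k (suc h)) + ∑ (suc N) (λ k → d * below (λ h' → term k h') h)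
      ≈⟨ +-cong (+-cong (∑-distribˡ (suc N) l (λ k → term k h)) (∑-distribˡ (suc N) u (λ k → term k (suc h))))
                (trans (∑-distribˡ (suc N) d (λ k → below (term k) h)) (*-congˡ (∑-below (suc N) (λ h' k → term k h') h))) ⟩
        l * expansion N h + u * expansion N (suc h) + d * below (expansion N) h ∎)) (+-identityˡ _)
      where
      term : ℕ → ℕ → Carrier
      term k h = fromℕ R (binom N k) * paths l u d k h * y ^ (N ∸ k)
      spread : ∀ c Y k → c * paths l u d (suc k) h * Y
                       ≈ l * (c * paths l u d k h * Y) + u * (c * paths l u d k (suc h) * Y)
                         + d * below (λ h' → c * paths l u d k h' * Y) h
      spread c Y k = begin
          c * (l * paths l u d k h + u * paths l u d k (suc h) + below (λ h' → d * paths l u d k h') h) * Y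
        ≈⟨ *-congʳ (*-congˡ (+-congˡ (below-distribˡ d _ h))) ⟩
          c * (l * paths l u d k h + u * paths l u d k (suc h) + d * below (paths l u d k) h) * Y
        ≈⟨ distribute c l _ u _ d _ Y ⟩
          l * (c * paths l u d k h * Y) + u * (c * paths l u d k (suc h) * Y) + d * (c * below (paths l u d k) h * Y)
        ≈⟨ +-congˡ (*-congˡ (sym (below-*ʳ c (paths l u d k) Y h))) ⟩
          l * (c * paths l u d k h * Y) + u * (c * paths l u d k (suc h) * Y) + d * below (λ h' → c * paths l u d k h' * Y) h ∎
        where
        distribute : ∀ c l A u B d D Y → c * (l * A + u * B + d * D) * Y ≈ l * (c * A * Y) + u * (c * B * Y) + d * (c * D * Y)
        distribute = solve 8 (λ c l A u B d D Y → c :* (l :* A :+ u :* B :+ d :* D) :* Y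
                                                  := l :* (c :* A :* Y) :+ u :* (c :* B :* Y) :+ d :* (c :* D :* Y)) refl

    expansion-zero : ∀ h → expansion 0 h ≈ paths l u d 0 h
    expansion-zero h = trans (+-identityʳ _) (trans (*-identityʳ _) (trans (*-congʳ (+-identityʳ 1#)) (*-identityˡ _)))

    paths-binomial : ∀ N h → paths (l + y) u d N h ≈ expansion N h
    paths-binomial zero zero = sym (expansion-zero 0)
    paths-binomial zero (suc h) = sym (expansion-zero (suc h))
    paths-binomial (suc N) h = begin
        (l + y) * paths (l + y) u d N h + u * paths (l + y) u d N (suc h) + below (λ h' → d * paths (l + y) u d N h') h
      ≈⟨ +-cong (+-cong (*-congˡ (paths-binomial N h)) (*-congˡ (paths-binomial N (suc h))))
                (trans (below-cong h (λ h' → *-congˡ (paths-binomial N h'))) (below-distribˡ d (expansion N) h)) ⟩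
        (l + y) * expansion N h + u * expansion N (suc h) + d * below (expansion N) h
      ≈⟨ regroup l u d y _ _ _ ⟩
        y * expansion N h + (l * expansion N h + u * expansion N (suc h) + d * below (expansion N) h)
      ≈⟨ sym (+-cong (expansion-shift N h) (expansion-step N h)) ⟩
        ∑ (suc (suc N)) kept + ∑ (suc (suc N)) shifted
      ≈⟨ sym (∑-+ (suc (suc N)) kept shifted) ⟩
        ∑ (suc (suc N)) (λ k → kept k + shifted k)
      ≈⟨ ∑-cong (suc (suc N)) (λ k → sym (pascal k)) ⟩
        expansion (suc N) h ∎
      where
      regroup : ∀ l u d y A B D → (l + y) * A + u * B + d * D ≈ y * A + (l * A + u * B + d * D)
      regroup = solve 7 (λ l u d y A B D → (l :+ y) :* A :+ u :* B :+ d :* D := y :* A :+ (l :* A :+ u :* B :+ d :* D)) refl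
      kept shifted : ℕ → Carrier
      kept k = fromℕ R (binom N k) * paths l u d k h * y ^ (suc N ∸ k)
      shifted k = fromℕ R (Binomial.below (binom N) k) * paths l u d k h * y ^ (suc N ∸ k)
      pascal : ∀ k → fromℕ R (binom (suc N) k) * paths l u d k h * y ^ (suc N ∸ k) ≈ kept k + shifted k
      pascal k = trans (*-congʳ (*-congʳ (trans (reflexive (≡.cong (fromℕ R) (binom-suc N k))) (fromℕ-+ (binom N k) (Binomial.below (binom N) k)))))
                       (distribʳ₂ _ _ _ _)

  module _ (x b : Carrier) where
    open Ballot using (ballot; ballot-vanish)

    ballotTerm : ℕ → ℕ → ℕ → Carrier
    ballotTerm N h k = fromℕ R (ballot N h k) * x ^ (2 ℕ.* k ℕ.+ h) * b ^ (N ∸ k)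

    belowTerm : ℕ → ℕ → ℕ → Carrier
    belowTerm N h k = below (λ h' → (b * x) * ballotTerm N h' k) h

    x^ : ∀ {m n} → m ≡ n → x ^ m ≈ x ^ n
    x^ m≡n = reflexive (≡.cong (x ^_) m≡n)

    pull : ∀ c X B → c * (x * X) * B ≈ x * (c * X * B)
    pull = solve 4 (λ x c X B → c :* (x :* X) :* B := x :* (c :* X :* B)) refl x

    ballotTerm-suc-zero : ∀ N h → ballotTerm (suc N) h 0 ≈ b * ballotTerm N h 0 + belowTerm N h 0
    ballotTerm-suc-zero N h =
      trans (*-congʳ (*-congʳ (fromℕ-+ (ballot N h 0) (Binomial.below (λ h' → ballot N h' 0) h))))
            (trans (distribʳ₂ _ _ _ _) (+-cong (pow-suc∸ b N 0 (ballot N h 0) (x ^ h) (λ ())) (descend h)))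
      where
      descend : ∀ h → fromℕ R (Binomial.below (λ h' → ballot N h' 0) h) * x ^ h * b ^ suc N ≈ belowTerm N h 0
      descend zero = zeroˡ₂ _ _
      descend (suc h) = rotate (fromℕ R (ballot N h 0)) (x ^ h) (b ^ N)
        where
        rotate : ∀ c X B → c * (x * X) * (b * B) ≈ (b * x) * (c * X * B)
        rotate = solve 5 (λ x b c X B → c :* (x :* X) :* (b :* B) := (b :* x) :* (c :* X :* B)) refl x b

    belowTerm-suc : ∀ N h k → fromℕ R (Binomial.below (λ h' → ballot N h' (suc k)) h) * x ^ (2 ℕ.* suc k ℕ.+ h) * b ^ (N ∸ k)
                           ≈ belowTerm N h (suc k)
    belowTerm-suc N zero k = zeroˡ₂ _ _
    belowTerm-suc N (suc h) k = begin
        fromℕ R (ballot N h (suc k)) * x ^ (2 ℕ.* suc k ℕ.+ suc h) * b ^ (N ∸ k)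
      ≈⟨ *-congʳ (*-congˡ (x^ (ℕ.+-suc (2 ℕ.* suc k) h))) ⟩
        fromℕ R (ballot N h (suc k)) * (x * x ^ (2 ℕ.* suc k ℕ.+ h)) * b ^ (N ∸ k)
      ≈⟨ pull _ _ _ ⟩
        x * (fromℕ R (ballot N h (suc k)) * x ^ (2 ℕ.* suc k ℕ.+ h) * b ^ (N ∸ k))
      ≈⟨ *-congˡ (pow-suc∸ b N (suc k) (ballot N h (suc k)) _ (ballot-vanish N h)) ⟩
        x * (b * ballotTerm N h (suc k))
      ≈⟨ x[bt]≈[bx]t _ ⟩
        (b * x) * ballotTerm N h (suc k) ∎
      where
      x[bt]≈[bx]t : ∀ t → x * (b * t) ≈ (b * x) * t
      x[bt]≈[bx]t = solve 3 (λ x b t → x :* (b :* t) := (b :* x) :* t) refl x b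

    ballotTerm-suc-suc : ∀ N h k → ballotTerm (suc N) h (suc k)
      ≈ (x * x) * ballotTerm N h k + b * ballotTerm N h (suc k) + x * ballotTerm N (suc h) k + belowTerm N h (suc k)
    ballotTerm-suc-suc N h k = begin
        fromℕ R (ballot N h k ℕ.+ ballot N h (suc k) ℕ.+ ballot N (suc h) k ℕ.+ Binomial.below (λ h' → ballot N h' (suc k)) h) * X * B
      ≈⟨ *-congʳ (*-congʳ (trans (fromℕ-+ (c₁ ℕ.+ c₂ ℕ.+ c₃) c₄) (+-congʳ (trans (fromℕ-+ (c₁ ℕ.+ c₂) c₃) (+-congʳ (fromℕ-+ c₁ c₂)))))) ⟩
        (fromℕ R c₁ + fromℕ R c₂ + fromℕ R c₃ + fromℕ R c₄) * X * B
      ≈⟨ distribʳ₄ (fromℕ R c₁) (fromℕ R c₂) (fromℕ R c₃) (fromℕ R c₄) X B ⟩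
        fromℕ R c₁ * X * B + fromℕ R c₂ * X * B + fromℕ R c₃ * X * B + fromℕ R c₄ * X * B
      ≈⟨ +-cong (+-cong (+-cong level-x² (pow-suc∸ b N (suc k) c₂ X (ballot-vanish N h))) up) (belowTerm-suc N h k) ⟩
        (x * x) * ballotTerm N h k + b * ballotTerm N h (suc k) + x * ballotTerm N (suc h) k + belowTerm N h (suc k) ∎
      where
      X B : Carrier
      X = x ^ (2 ℕ.* suc k ℕ.+ h)
      B = b ^ (N ∸ k)
      c₁ c₂ c₃ c₄ : ℕ
      c₁ = ballot N h k
      c₂ = ballot N h (suc k)
      c₃ = ballot N (suc h) k
      c₄ = Binomial.below (λ h' → ballot N h' (suc k)) h
      distribʳ₄ : ∀ c₁ c₂ c₃ c₄ X B → (c₁ + c₂ + c₃ + c₄) * X * B ≈ c₁ * X * B + c₂ * X * B + c₃ * X * B + c₄ * X * B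
      distribʳ₄ = solve 6 (λ c₁ c₂ c₃ c₄ X B → (c₁ :+ c₂ :+ c₃ :+ c₄) :* X :* B
                                               := c₁ :* X :* B :+ c₂ :* X :* B :+ c₃ :* X :* B :+ c₄ :* X :* B) refl
      level-x² : fromℕ R c₁ * X * B ≈ (x * x) * ballotTerm N h k
      level-x² = trans (*-congʳ (*-congˡ (x^ (exponent₁ k h))))
                       (trans (pull _ _ B) (trans (*-congˡ (pull _ _ B)) (sym (*-assoc x x _))))
        where
        exponent₁ : ∀ k h → 2 ℕ.* suc k ℕ.+ h ≡ suc (suc (2 ℕ.* k ℕ.+ h))
        exponent₁ = solve-∀
      up : fromℕ R c₃ * X * B ≈ x * ballotTerm N (suc h) k
      up = trans (*-congʳ (*-congˡ (x^ (exponent₂ k h)))) (pull _ _ B)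
        where
        exponent₂ : ∀ k h → 2 ℕ.* suc k ℕ.+ h ≡ suc (2 ℕ.* k ℕ.+ suc h)
        exponent₂ = solve-∀
    paths-ballot : ∀ N h {L} → N < L → paths (x * x + b) x (b * x) N h ≈ ∑ L (ballotTerm N h)
    paths-ballot zero h {suc L} _ = sym (trans (+-congˡ (∑-zero L higher-vanish)) (initial h))
      where
      higher-vanish : ∀ k → ballotTerm 0 h (suc k) ≈ 0#
      higher-vanish k = trans (*-congʳ (*-congʳ (reflexive (≡.cong (fromℕ R) (ballot-vanish 0 h (s≤s z≤n)))))) (zeroˡ₂ _ _)
      initial : ∀ h → ballotTerm 0 h 0 + 0# ≈ paths (x * x + b) x (b * x) 0 h
      initial zero = trans (+-identityʳ _) (trans (*-identityʳ _) (trans (*-congʳ (+-identityʳ 1#)) (*-identityˡ 1#)))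
      initial (suc h) = trans (+-identityʳ _) (zeroˡ₂ _ _)
    paths-ballot (suc N) h {suc L} (s≤s N<L) = sym (begin
        ballotTerm (suc N) h 0 + ∑ L (λ k → ballotTerm (suc N) h (suc k))
      ≈⟨ +-cong (ballotTerm-suc-zero N h) (∑-cong L (ballotTerm-suc-suc N h)) ⟩
        (b * τ 0 + τ↓ 0) + ∑ L (λ k → (x * x) * τ k + b * τ (suc k) + x * τ↑ k + τ↓ (suc k))
      ≈⟨ +-congˡ (trans (∑-+₄ L (λ k → (x * x) * τ k) (λ k → b * τ (suc k)) (λ k → x * τ↑ k) (λ k → τ↓ (suc k)))
                        (+-congʳ (+-cong (+-cong (∑-distribˡ L (x * x) τ) (∑-distribˡ L b (λ k → τ (suc k))))
                                         (∑-distribˡ L x τ↑)))) ⟩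
        (b * τ 0 + τ↓ 0) + ((x * x) * ∑ L τ + b * ∑ L (λ k → τ (suc k)) + x * ∑ L τ↑ + ∑ L (λ k → τ↓ (suc k)))
      ≈⟨ regroup b (τ 0) (τ↓ 0) (x * x) (∑ L τ) (∑ L (λ k → τ (suc k))) x (∑ L τ↑) (∑ L (λ k → τ↓ (suc k))) ⟩
        (x * x) * ∑ L τ + b * ∑ (suc L) τ + x * ∑ L τ↑ + ∑ (suc L) τ↓
      ≈⟨ +-cong (+-cong (+-cong (*-congˡ (sym (paths-ballot N h N<L))) (*-congˡ (sym (paths-ballot N h N<1+L))))
                        (*-congˡ (sym (paths-ballot N (suc h) N<L))))
                (trans (∑-below (suc L) (λ h' k → (b * x) * ballotTerm N h' k) h)
                       (below-cong h (λ h' → trans (∑-distribˡ (suc L) (b * x) (ballotTerm N h'))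
                                                   (*-congˡ (sym (paths-ballot N h' N<1+L)))))) ⟩
        (x * x) * P + b * P + x * paths (x * x + b) x (b * x) N (suc h) + below (λ h' → (b * x) * paths (x * x + b) x (b * x) N h') h
      ≈⟨ +-congʳ (+-congʳ (sym (distribʳ P (x * x) b))) ⟩
        paths (x * x + b) x (b * x) (suc N) h ∎)
      where
      τ τ↑ τ↓ : ℕ → Carrier
      τ = ballotTerm N h
      τ↑ = ballotTerm N (suc h)
      τ↓ = belowTerm N h
      P : Carrier
      P = paths (x * x + b) x (b * x) N h
      N<1+L : N < suc L
      N<1+L = ℕ.m≤n⇒m≤1+n N<L
      regroup : ∀ b T₀ D₀ xx A B x' C D' → (b * T₀ + D₀) + (xx * A + b * B + x' * C + D')
                                           ≈ xx * A + b * (T₀ + B) + x' * C + (D₀ + D')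
      regroup = solve 9 (λ b T₀ D₀ xx A B x' C D' → (b :* T₀ :+ D₀) :+ (xx :* A :+ b :* B :+ x' :* C :+ D')
                                                    := xx :* A :+ b :* (T₀ :+ B) :+ x' :* C :+ (D₀ :+ D')) refl

  sumMap : {A : Set} → (A → Carrier) → List A → Carrier
  sumMap f xs = sumR R (map f xs)

  module _ {A : Set} where
    sumMap-cong : ∀ {f g : A → Carrier} xs → (∀ w → f w ≈ g w) → sumMap f xs ≈ sumMap g xs
    sumMap-cong [] f≈g = refl
    sumMap-cong (w ∷ xs) f≈g = +-cong (f≈g w) (sumMap-cong xs f≈g)

    sumMap-+ : ∀ (f g : A → Carrier) xs → sumMap (λ w → f w + g w) xs ≈ sumMap f xs + sumMap g xs
    sumMap-+ f g [] = sym (+-identityˡ 0#)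
    sumMap-+ f g (w ∷ xs) = trans (+-congˡ (sumMap-+ f g xs)) (interchange _ _ _ _)
      where
      interchange : ∀ a b c d → (a + b) + (c + d) ≈ (a + c) + (b + d)
      interchange = solve 4 (λ a b c d → (a :+ b) :+ (c :+ d) := (a :+ c) :+ (b :+ d)) refl

    sumMap-distribˡ : ∀ a (f : A → Carrier) xs → sumMap (λ w → a * f w) xs ≈ a * sumMap f xs
    sumMap-distribˡ a f [] = sym (zeroʳ a)
    sumMap-distribˡ a f (w ∷ xs) = trans (+-congˡ (sumMap-distribˡ a f xs)) (sym (distribˡ a _ _))

    sumMap-if : ∀ c (f : A → Carrier) xs → sumMap (λ w → if c then f w else 0#) xs ≈ (if c then sumMap f xs else 0#)
    sumMap-if true f xs = refl
    sumMap-if false f [] = refl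
    sumMap-if false f (w ∷ xs) = trans (+-identityˡ _) (sumMap-if false f xs)

    sumMap-++ : ∀ (f : A → Carrier) xs ys → sumMap f (xs ++ ys) ≈ sumMap f xs + sumMap f ys
    sumMap-++ f [] ys = sym (+-identityˡ _)
    sumMap-++ f (w ∷ xs) ys = trans (+-congˡ (sumMap-++ f xs ys)) (sym (+-assoc _ _ _))

    sumR-filterᵇ : ∀ (p : A → Bool) (f : A → Carrier) xs → sumR R (map f (filterᵇ p xs)) ≈ sumMap (λ w → if p w then f w else 0#) xs
    sumR-filterᵇ p f [] = refl
    sumR-filterᵇ p f (w ∷ xs) with p w
    ... | true = +-congˡ (sumR-filterᵇ p f xs)
    ... | false = trans (sumR-filterᵇ p f xs) (sym (+-identityˡ _))

  sumMap-concatMap : {A B : Set} (f : B → Carrier) (g : A → List B) (xs : List A) →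
                     sumMap f (concatMap g xs) ≈ sumMap (λ w → sumMap f (g w)) xs
  sumMap-concatMap f g [] = refl
  sumMap-concatMap f g (w ∷ xs) = trans (sumMap-++ f (g w) (concatMap g xs)) (+-congˡ (sumMap-concatMap f g xs))

  if-T : ∀ {c : Bool} {X : Carrier} → T c → (if c then X else 0#) ≡ X
  if-T {true} _ = ≡.refl

  if-¬T : ∀ {c : Bool} {X : Carrier} → ¬ T c → (if c then X else 0#) ≡ 0#
  if-¬T {true} ¬t = ⊥-elim (¬t tt)
  if-¬T {false} _ = ≡.refl

  arrived : ∀ {m x y} → x ≡ m → y ≡ m → T (validFrom m x y [])
  arrived {m} ≡.refl ≡.refl = Equivalence.from T-∧ (ℕ.≡⇒≡ᵇ m m ≡.refl , ℕ.≡⇒≡ᵇ m m ≡.refl)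

  stranded : ∀ x h → ¬ T (validFrom (x ℕ.+ suc h ℕ.+ 0) x (x ℕ.+ (suc h ℕ.+ suc h)) [])
  stranded x h t = ℕ.m+1+n≢m _ (≡.trans (≡.sym (overshoot x h)) (ℕ.≡ᵇ⇒≡ _ _ (proj₂ (Equivalence.to T-∧ t))))
    where
    overshoot : ∀ x h → x ℕ.+ (suc h ℕ.+ suc h) ≡ x ℕ.+ suc h ℕ.+ 0 ℕ.+ suc h
    overshoot = solve-∀

  module _ (a b : Carrier) where
    weight : List Step → Carrier
    weight w = a ^ #D w * b ^ #E₂ w

    validWeight : ℕ → ℕ → ℕ → List Step → Carrier
    validWeight m x y w = if validFrom m x y w then weight w else 0#

    validWeight-D : ∀ m x y w → validWeight m x y (D ∷ w) ≈ a * validWeight m (suc x) (suc y) w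
    validWeight-D m x y w with validFrom m (suc x) (suc y) w
    ... | true = *-assoc _ _ _
    ... | false = sym (zeroʳ a)

    validWeight-E₂ : ∀ m x y w → validWeight m x y (E₂ ∷ w)
                     ≈ (if suc (suc x) ℕ.≤ᵇ y then b * validWeight m (suc (suc x)) y w else 0#)
    validWeight-E₂ m x y w with suc (suc x) ℕ.≤ᵇ y | validFrom m (suc (suc x)) y w
    ... | true | true = x[yz]≈y[xz] _ _ _
      where
      x[yz]≈y[xz] : ∀ x y z → x * (y * z) ≈ y * (x * z)
      x[yz]≈y[xz] = solve 3 (λ x y z → x :* (y :* z) := y :* (x :* z)) refl
    ... | true | false = sym (zeroʳ b)
    ... | false | _ = refl

    endingAt : ℕ → ℕ → ℕ → ℕ → Carrier
    endingAt m L x y = sumMap (validWeight m x y) (words L)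

    endingAt-suc : ∀ m L x y → endingAt m (suc L) x y
      ≈ a * endingAt m L (suc x) (suc y) + endingAt m L x (suc (suc y))
        + (if suc (suc x) ℕ.≤ᵇ y then b * endingAt m L (suc (suc x)) y else 0#)
    endingAt-suc m L x y = begin
        sumMap (validWeight m x y) (concatMap extensions (words L))
      ≈⟨ sumMap-concatMap (validWeight m x y) extensions (words L) ⟩
        sumMap (λ w → sumMap (validWeight m x y) (extensions w)) (words L)
      ≈⟨ sumMap-cong (words L) split ⟩
        sumMap (λ w → a * V↗ w + V↑ w + E w) (words L)
      ≈⟨ trans (sumMap-+ (λ w → a * V↗ w + V↑ w) E (words L)) (+-congʳ (sumMap-+ (λ w → a * V↗ w) V↑ (words L))) ⟩
        sumMap (λ w → a * V↗ w) (words L) + sumMap V↑ (words L) + sumMap E (words L)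
      ≈⟨ +-cong (+-congʳ (sumMap-distribˡ a V↗ (words L)))
                (trans (sumMap-if guard (λ w → b * V→ w) (words L)) (ifCong (sumMap-distribˡ b V→ (words L)))) ⟩
        a * endingAt m L (suc x) (suc y) + endingAt m L x (suc (suc y))
          + (if guard then b * endingAt m L (suc (suc x)) y else 0#) ∎
      where
      extensions : List Step → List (List Step)
      extensions w = (D ∷ w) ∷ (N₂ ∷ w) ∷ (E₂ ∷ w) ∷ []
      guard : Bool
      guard = suc (suc x) ℕ.≤ᵇ y
      V↗ V↑ V→ E : List Step → Carrier
      V↗ = validWeight m (suc x) (suc y)
      V↑ = validWeight m x (suc (suc y))
      V→ = validWeight m (suc (suc x)) y
      E w = if guard then b * V→ w else 0#
      split : ∀ w → sumMap (validWeight m x y) (extensions w) ≈ a * V↗ w + V↑ w + E w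
      split w = trans (+-congˡ (+-congˡ (+-identityʳ _)))
                      (trans (+-cong (validWeight-D m x y w) (+-congˡ (validWeight-E₂ m x y w))) (sym (+-assoc _ _ _)))
      ifCong : ∀ {X X'} → X ≈ X' → (if guard then X else 0#) ≈ (if guard then X' else 0#)
      ifCong with guard
      ... | true = λ X≈X' → X≈X'
      ... | false = λ _ → refl

    -- a word from (x, x + 2h) reaching (m, m) in L steps is a path from height h down to 0 with level
    -- steps D, up steps N₂ and down steps E₂; the E₂ steps are forbidden exactly at height 0
    endingAt≈paths : ∀ L x h {m y} → y ≡ x ℕ.+ (h ℕ.+ h) → m ≡ x ℕ.+ h ℕ.+ L → endingAt m L x y ≈ paths a 1# b L h
    endingAt≈paths zero x zero ≡.refl ≡.refl =
      trans (+-identityʳ _) (trans (reflexive (if-T (arrived x≡m (≡.sym (ℕ.+-identityʳ (x ℕ.+ 0)))))) (*-identityˡ 1#))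
      where
      x≡m : x ≡ x ℕ.+ 0 ℕ.+ 0
      x≡m = ≡.sym (≡.trans (ℕ.+-identityʳ (x ℕ.+ 0)) (ℕ.+-identityʳ x))
    endingAt≈paths zero x (suc h) ≡.refl ≡.refl = trans (+-identityʳ _) (reflexive (if-¬T (stranded x h)))
    endingAt≈paths (suc L) x h ≡.refl ≡.refl = begin
        endingAt (x ℕ.+ h ℕ.+ suc L) (suc L) x (x ℕ.+ (h ℕ.+ h))
      ≈⟨ endingAt-suc _ L x _ ⟩
        a * endingAt _ L (suc x) (suc (x ℕ.+ (h ℕ.+ h))) + endingAt _ L x (suc (suc (x ℕ.+ (h ℕ.+ h))))
          + (if suc (suc x) ℕ.≤ᵇ x ℕ.+ (h ℕ.+ h) then b * endingAt _ L (suc (suc x)) (x ℕ.+ (h ℕ.+ h)) else 0#)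
      ≈⟨ +-cong (+-cong (*-congˡ (endingAt≈paths L (suc x) h ≡.refl (ℕ.+-suc (x ℕ.+ h) L)))
                        (trans (endingAt≈paths L x (suc h) (up-y x h) (up-m x h L)) (sym (*-identityˡ _))))
                (down h) ⟩
        a * paths a 1# b L h + 1# * paths a 1# b L (suc h) + below (λ h' → b * paths a 1# b L h') h ∎
      where
      up-y : ∀ x h → suc (suc (x ℕ.+ (h ℕ.+ h))) ≡ x ℕ.+ (suc h ℕ.+ suc h)
      up-y = solve-∀
      up-m : ∀ x h L → x ℕ.+ h ℕ.+ suc L ≡ x ℕ.+ suc h ℕ.+ L
      up-m = solve-∀
      down-y : ∀ x h → x ℕ.+ (suc h ℕ.+ suc h) ≡ suc (suc x) ℕ.+ (h ℕ.+ h)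
      down-y = solve-∀
      down-m : ∀ x h L → x ℕ.+ suc h ℕ.+ suc L ≡ suc (suc x) ℕ.+ h ℕ.+ L
      down-m = solve-∀
      down : ∀ h → (if suc (suc x) ℕ.≤ᵇ x ℕ.+ (h ℕ.+ h) then b * endingAt (x ℕ.+ h ℕ.+ suc L) L (suc (suc x)) (x ℕ.+ (h ℕ.+ h)) else 0#)
                   ≈ below (λ h' → b * paths a 1# b L h') h
      down zero = reflexive (if-¬T (λ t → ℕ.1+n≰n
                    (ℕ.≤-trans (ℕ.n≤1+n (suc x)) (ℕ.≤-trans (ℕ.≤ᵇ⇒≤ _ _ t) (ℕ.≤-reflexive (ℕ.+-identityʳ x))))))
      down (suc h) = trans (reflexive (if-T (ℕ.≤⇒≤ᵇ (ℕ.≤-trans (ℕ.m≤m+n (suc (suc x)) (h ℕ.+ h)) (ℕ.≤-reflexive (≡.sym (down-y x h)))))))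
                           (*-congˡ (endingAt≈paths L (suc (suc x)) h (down-y x h) (down-m x h L)))

    Motzkin≈paths : ∀ k → Motzkin R a b k ≈ paths a 1# b k 0
    Motzkin≈paths k = trans (sumR-filterᵇ (isMotzkin k) weight (words k)) (endingAt≈paths k 0 0 ≡.refl ≡.refl)

  paths-Motzkin : ∀ a b x k → paths (a * x) (1# * x) (b * x) k 0 ≈ x ^ k * Motzkin R a b k
  paths-Motzkin a b x k = trans (paths-scale a 1# b x k 0) (*-congˡ (sym (Motzkin≈paths a b k)))

  p+[q-p+r]≈q+r : ∀ p q r → p + (q - p + r) ≈ q + r
  p+[q-p+r]≈q+r p q r = begin
      p + ((q + - p) + r) ≈⟨ sym (+-assoc _ _ _) ⟩
      (p + (q + - p)) + r ≈⟨ +-congʳ (swap p q (- p)) ⟩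
      (q + (p + - p)) + r ≈⟨ +-congʳ (+-congˡ (-‿inverseʳ p)) ⟩
      (q + 0#) + r        ≈⟨ +-congʳ (+-identityʳ q) ⟩
      q + r ∎
    where
    swap : ∀ p q r → p + (q + r) ≈ q + (p + r)
    swap = solve 3 (λ p q r → p :+ (q :+ r) := q :+ (p :+ r)) refl

  narayana-expansion : ∀ N (a b x : Carrier) →
    Σ< R (suc N) (λ k → fromℕ R (((suc N C k) ℕ.* (suc N C suc k)) ℕ./ suc N) * x ^ (2 ℕ.* k) * b ^ (N ∸ k))
    ≈ Σ< R (suc N) (λ k → fromℕ R (N C k) * Motzkin R a b k * x ^ k * (x * x - a * x + b) ^ (N ∸ k))
  narayana-expansion N a b x = begin
      Σ< R (suc N) (λ k → fromℕ R (((suc N C k) ℕ.* (suc N C suc k)) ℕ./ suc N) * x ^ (2 ℕ.* k) * b ^ (N ∸ k))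
    ≡⟨ Σ<≡∑ (suc N) _ ⟩
      ∑ (suc N) (λ k → fromℕ R (((suc N C k) ℕ.* (suc N C suc k)) ℕ./ suc N) * x ^ (2 ℕ.* k) * b ^ (N ∸ k))
    ≈⟨ ∑-cong (suc N) (λ k → reflexive (≡.cong₂ (λ n e → fromℕ R n * x ^ e * b ^ (N ∸ k))
                                         (≡.sym (Ballot.ballot≡narayana N k)) (≡.sym (ℕ.+-identityʳ (2 ℕ.* k))))) ⟩
      ∑ (suc N) (ballotTerm x b N 0)
    ≈⟨ sym (paths-ballot x b N 0 (ℕ.n<1+n N)) ⟩
      paths (x * x + b) x (b * x) N 0
    ≈⟨ paths-cong (sym (p+[q-p+r]≈q+r (a * x) (x * x) b)) (sym (*-identityˡ x)) refl N 0 ⟩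
      paths (a * x + y) (1# * x) (b * x) N 0
    ≈⟨ paths-binomial (a * x) (1# * x) (b * x) y N 0 ⟩
      ∑ (suc N) (λ k → fromℕ R (binom N k) * paths (a * x) (1# * x) (b * x) k 0 * y ^ (N ∸ k))
    ≈⟨ ∑-cong (suc N) (λ k → trans (*-congʳ (*-cong (reflexive (≡.cong (fromℕ R) (Binomial.binom≡C N k))) (paths-Motzkin a b x k)))
                                   (rearrange _ _ _ (y ^ (N ∸ k)))) ⟩
      ∑ (suc N) (λ k → fromℕ R (N C k) * Motzkin R a b k * x ^ k * y ^ (N ∸ k))
    ≡⟨ ≡.sym (Σ<≡∑ (suc N) _) ⟩
      Σ< R (suc N) (λ k → fromℕ R (N C k) * Motzkin R a b k * x ^ k * y ^ (N ∸ k)) ∎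
    where
    y : Carrier
    y = x * x - a * x + b
    rearrange : ∀ c X M Y → c * (X * M) * Y ≈ c * M * X * Y
    rearrange = solve 4 (λ c X M Y → c :* (X :* M) :* Y := c :* M :* X :* Y) refl

open import Data.Nat using (_*_; _/_)

theorem1p1 : {c ℓ : Level} (R : CommutativeRing c ℓ) (n : ℕ) .{{_ : NonZero n}}
    (a b x : CommutativeRing.Carrier R) →
    CommutativeRing._≈_ R
      (Σ< R n (λ k → CommutativeRing._*_ R (CommutativeRing._*_ R (fromℕ R (((n C k) * (n C suc k)) / n)) (pow R x (2 * k))) (pow R b (n ∸ 1 ∸ k))))
      (Σ< R n (λ k → CommutativeRing._*_ R (CommutativeRing._*_ R (CommutativeRing._*_ R (fromℕ R ((n ∸ 1) C k)) (Motzkin R a b k)) (pow R x k)) (pow R (CommutativeRing._+_ R (CommutativeRing._-_ R (CommutativeRing._*_ R x x) (CommutativeRing._*_ R a x)) b) (n ∸ 1 ∸ k))))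
theorem1p1 R zero {{n≢0}} = ⊥-elim (NonZero.nonZero n≢0)
theorem1p1 R (suc N) = WeightedPaths.narayana-expansion R N
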